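{- The modal logic $8$f is strongly complete for the class of all non-degenerate elliptic $1$-planes: every $8$f-consistent set of modal formulas is satisfiable in some model on some non-degenerate elliptic $1$-plane.
   Context: Modal formulas are built from countably many propositional variables with $\neg,\wedge,\Box$; $\Diamond=\neg\Box\neg$. A $1$-frame is $(X,I)$ with $I\subseteq X\times X$; a model adds a valuation of variables as subsets of $X$, with $\Box\varphi$ true at $a$ iff $\varphi$ is true at all $b$ with $aIb$. A set is satisfiable in a model if all its members are true at some common point. A normal logic contains all tautologies and instances of $\Box(\varphi\to\psi)\to(\Box\varphi\to\Box\psi)$, closed under modus ponens and necessitation. $12$g is the smallest normal logic containing all instances of $\Box\varphi\to\Diamond\varphi$, $\Diamond\Box\varphi\to\varphi$, $\Box\Box\varphi\to\Box\Box\Box\Box\varphi$; $8$f is the smallest normal logic containing $12$g and all instances of $\Box\Box\Box\varphi\to\varphi$. A set $\Sigma$ is $\Lambda$-consistent if no finite conjunction $\varphi$ of its members has $\neg\varphi\in\Lambda$. With $I^2$ the composition of $I$ with itself, an elliptic $1$-plane is a $1$-frame satisfying O5: $aI^2b$ for all $a,b$, and O3: $aIbIcIdIa$ implies $a=c$ or $b=d$. It is non-degenerate if there exist $a,b,c,d$ with $aIbIcId$, $a\ne c$, $b\ne d$, and neither $aIc$ nor $bId$. -}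

module Defs where

open import Data.Nat using (ℕ)
open import Data.Bool using (Bool; true; false; not; _∧_)
open import Data.List using (List; []; _∷_)
open import Data.List.Relation.Unary.All using (All)
open import Data.Product using (Σ; _×_; ∃; _,_)
open import Data.Sum using (_⊎_)
open import Data.Empty using (⊥)
open import Relation.Nullary using (¬_)
open import Relation.Binary.PropositionalEquality using (_≡_; _≢_)

infixr 6 _∧ₘ_
infixr 5 _⇒ₘ_
infix 8 ¬ₘ_ □_ ◇_
data Formula : Set where
  var  : ℕ → Formula
  ¬ₘ_  : Formula → Formula
  _∧ₘ_ : Formula → Formula → Formula
  □_   : Formula → Formula

◇_ : Formula → Formula
◇ φ = ¬ₘ □ ¬ₘ φ

_⇒ₘ_ : Formula → Formula → Formula
φ ⇒ₘ ψ = ¬ₘ (φ ∧ₘ ¬ₘ ψ)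

⊥ₘ : Formula
⊥ₘ = var 0 ∧ₘ ¬ₘ var 0

⊤ₘ : Formula
⊤ₘ = ¬ₘ ⊥ₘ

⋀ : List Formula → Formula
⋀ []       = ⊤ₘ
⋀ (φ ∷ φs) = φ ∧ₘ ⋀ φs

-- Tautologies: true under every Boolean assignment to the
-- propositional "atoms" (variables and boxed formulas).

evalB : (Formula → Bool) → Formula → Bool
evalB v (var n)  = v (var n)
evalB v (¬ₘ φ)   = not (evalB v φ)
evalB v (φ ∧ₘ ψ) = evalB v φ ∧ evalB v ψ
evalB v (□ φ)    = v (□ φ)

Tautology : Formula → Set
Tautology φ = (v : Formula → Bool) → evalB v φ ≡ true

data 8f : Formula → Set where
  taut : ∀ {φ} → Tautology φ → 8f φ
  K    : ∀ φ ψ → 8f (□ (φ ⇒ₘ ψ) ⇒ₘ (□ φ ⇒ₘ □ ψ))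
  axD  : ∀ φ → 8f (□ φ ⇒ₘ ◇ φ)
  axB  : ∀ φ → 8f (◇ □ φ ⇒ₘ φ)
  ax4  : ∀ φ → 8f (□ □ φ ⇒ₘ □ □ □ □ φ)
  ax3  : ∀ φ → 8f (□ □ □ φ ⇒ₘ φ)
  mp   : ∀ {φ ψ} → 8f (φ ⇒ₘ ψ) → 8f φ → 8f ψ
  nec  : ∀ {φ} → 8f φ → 8f (□ φ)

FormulaSet : Set₁
FormulaSet = Formula → Set

Consistent : (Formula → Set) → FormulaSet → Set
Consistent Λ S = (φs : List Formula) → All S φs → ¬ Λ (¬ₘ ⋀ φs)

record Frame : Set₁ where
  field
    X : Set
    I : X → X → Set

record Model (F : Frame) : Set₁ where
  field
    V : ℕ → Frame.X F → Set

Sat : (F : Frame) → Model F → Frame.X F → Formula → Set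
Sat F M a (var n)  = Model.V M n a
Sat F M a (¬ₘ φ)   = ¬ Sat F M a φ
Sat F M a (φ ∧ₘ ψ) = Sat F M a φ × Sat F M a ψ
Sat F M a (□ φ)    = ∀ b → Frame.I F a b → Sat F M b φ

SatisfiableIn : (F : Frame) → Model F → FormulaSet → Set
SatisfiableIn F M S = Σ (Frame.X F) λ a → ∀ φ → S φ → Sat F M a φ

I² : (F : Frame) → Frame.X F → Frame.X F → Set
I² F a b = Σ (Frame.X F) λ c → Frame.I F a c × Frame.I F c b

O5 : Frame → Set
O5 F = ∀ a b → I² F a b

O3 : Frame → Set
O3 F = ∀ a b c d → Frame.I F a b → Frame.I F b c → Frame.I F c d →
       Frame.I F d a → (a ≡ c) ⊎ (b ≡ d)

IsEllipticPlane : Frame → Set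
IsEllipticPlane F = O5 F × O3 F

NonDegenerate : Frame → Set
NonDegenerate F =
  Σ (Frame.X F) λ a → Σ (Frame.X F) λ b → Σ (Frame.X F) λ c → Σ (Frame.X F) λ d →
    Frame.I F a b × Frame.I F b c × Frame.I F c d ×
    a ≢ c × b ≢ d × ¬ Frame.I F a c × ¬ Frame.I F b d

{-# OPTIONS --safe #-}
-- The satisfying model is a canonical model on a freely generated plane.
-- Starting from a root, nodes are added by two operations: witness x ψ, a new
-- neighbour of x refuting ψ whenever ¬□ψ holds at x, and join x y, a new
-- common neighbour of x and y, admitted only while x and y have none. Each
-- node is labelled by a Lindenbaum extension of the formulas boxed at its
-- parents; adjacency is parenthood in either direction, and axiom B makes the
-- canonical relation symmetric, so the truth lemma goes through. Joins are
-- consistent because axiom 4 together with □□φ → φ and □□□φ → φ makes □□φ at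
-- x force φ at every node reachable from x, whatever the distance. O5 holds
-- because every two nodes either share a neighbour or may be joined. O3 holds
-- because a 4-cycle is not a directed cycle of parents (ranks increase), so it
-- has a vertex with two parents; that vertex is their join, and a join is the
-- only common neighbour of its parents.

module Submission where

open import Defs
open import Data.Nat using (ℕ; zero; suc; _+_; _<_; _<?_; _≤′_; _⊔_; s≤s)
open import Data.Nat.Properties using (m≤m⊔n; m≤n⊔m; ≤⇒≤′; <-cmp; <-irrefl; <-trans; <-asym; m≤m+n; m≤n+m; n<1+n)
import Data.Nat.Properties as ℕ
open import Data.Nat.Binary using (ℕᵇ; zero; 2[1+_]; 1+[2_]; toℕ)
open import Data.Nat.Binary.Properties using (toℕ-injective)
open import Data.Bool using (Bool; true; false; not; _∧_; T)
open import Data.Bool.Properties using (T-≡; T-∧; T-irrelevant)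
open import Data.List using (List; []; _∷_; _++_)
open import Data.List.Properties using (∷-injectiveʳ)
open import Data.List.Relation.Unary.All using (All; []; _∷_) renaming (map to All-map)
open import Data.List.Relation.Unary.All.Properties using (++⁺; ++⁻)
open import Data.List.Relation.Unary.Any using (Any; here; there; any?)
open import Data.List.Membership.Propositional using (_∈_; lose; find)
open import Data.Product using (Σ; _×_; ∃; _,_; proj₁; proj₂)
open import Data.Sum using (_⊎_; inj₁; inj₂; [_,_]; swap; map; map₁)
open import Data.Empty using (⊥; ⊥-elim)
open import Data.Unit using (tt)
open import Function using (_∘_; _⇔_; mk⇔; Equivalence)
open import Relation.Nullary using (¬_; Dec; yes; no; ¬?)
open import Relation.Nullary.Decidable using (T?; decidable-stable; ⌊_⌋; _⊎-dec_; toWitness; fromWitness)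
open import Relation.Binary using (tri<; tri≈; tri>)
open import Relation.Binary.PropositionalEquality using (_≡_; refl; sym; trans; cong; subst)

open Equivalence using (to; from)

unary : ℕ → List Bool → List Bool
unary zero    r = false ∷ r
unary (suc n) r = true ∷ unary n r

-- A prefix code: the continuation argument [r] is what makes injectivity
-- compose over the two subformulas of a conjunction.
encode : Formula → List Bool → List Bool
encode (var n)  r = false ∷ false ∷ unary n r
encode (¬ₘ φ)   r = false ∷ true ∷ encode φ r
encode (φ ∧ₘ ψ) r = true ∷ false ∷ encode φ (encode ψ r)
encode (□ φ)    r = true ∷ true ∷ encode φ r

∷∷-injective : ∀ {a b : Bool} {r s} → a ∷ b ∷ r ≡ a ∷ b ∷ s → r ≡ s
∷∷-injective = ∷-injectiveʳ ∘ ∷-injectiveʳ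

unary-injective : ∀ m n {r s} → unary m r ≡ unary n s → m ≡ n × r ≡ s
unary-injective zero    zero    e = refl , ∷-injectiveʳ e
unary-injective (suc m) (suc n) e with unary-injective m n (∷-injectiveʳ e)
... | refl , r≡s = refl , r≡s

encode-injective : ∀ φ ψ {r s} → encode φ r ≡ encode ψ s → φ ≡ ψ × r ≡ s
encode-injective (var m) (var n) e with unary-injective m n (∷∷-injective e)
... | refl , r≡s = refl , r≡s
encode-injective (¬ₘ φ) (¬ₘ ψ) e with encode-injective φ ψ (∷∷-injective e)
... | refl , r≡s = refl , r≡s
encode-injective (φ₁ ∧ₘ φ₂) (ψ₁ ∧ₘ ψ₂) e with encode-injective φ₁ ψ₁ (∷∷-injective e)
... | refl , e₂ with encode-injective φ₂ ψ₂ e₂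
...   | refl , r≡s = refl , r≡s
encode-injective (□ φ) (□ ψ) e with encode-injective φ ψ (∷∷-injective e)
... | refl , r≡s = refl , r≡s
encode-injective (var _)  (¬ₘ _)   ()
encode-injective (var _)  (_ ∧ₘ _) ()
encode-injective (var _)  (□ _)    ()
encode-injective (¬ₘ _)   (var _)  ()
encode-injective (¬ₘ _)   (_ ∧ₘ _) ()
encode-injective (¬ₘ _)   (□ _)    ()
encode-injective (_ ∧ₘ _) (var _)  ()
encode-injective (_ ∧ₘ _) (¬ₘ _)   ()
encode-injective (_ ∧ₘ _) (□ _)    ()
encode-injective (□ _)    (var _)  ()
encode-injective (□ _)    (¬ₘ _)   ()
encode-injective (□ _)    (_ ∧ₘ _) ()

toℕᵇ : List Bool → ℕᵇ
toℕᵇ []          = zero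
toℕᵇ (false ∷ l) = 2[1+ toℕᵇ l ]
toℕᵇ (true ∷ l)  = 1+[2 toℕᵇ l ]

toℕᵇ-injective : ∀ l m → toℕᵇ l ≡ toℕᵇ m → l ≡ m
toℕᵇ-injective []          []          _ = refl
toℕᵇ-injective (false ∷ l) (false ∷ m) e = cong (false ∷_) (toℕᵇ-injective l m (2[1+]-injective e))
  where 2[1+]-injective : ∀ {x y} → 2[1+ x ] ≡ 2[1+ y ] → x ≡ y
        2[1+]-injective refl = refl
toℕᵇ-injective (true ∷ l)  (true ∷ m)  e = cong (true ∷_) (toℕᵇ-injective l m (1+[2]-injective e))
  where 1+[2]-injective : ∀ {x y} → 1+[2 x ] ≡ 1+[2 y ] → x ≡ y
        1+[2]-injective refl = refl
toℕᵇ-injective []          (false ∷ _) ()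
toℕᵇ-injective []          (true ∷ _)  ()
toℕᵇ-injective (false ∷ _) []          ()
toℕᵇ-injective (false ∷ _) (true ∷ _)  ()
toℕᵇ-injective (true ∷ _)  []          ()
toℕᵇ-injective (true ∷ _)  (false ∷ _) ()

bitsToℕ : List Bool → ℕ
bitsToℕ = toℕ ∘ toℕᵇ

bitsToℕ-injective : ∀ {l m} → bitsToℕ l ≡ bitsToℕ m → l ≡ m
bitsToℕ-injective {l} {m} = toℕᵇ-injective l m ∘ toℕ-injective

code : Formula → ℕ
code φ = bitsToℕ (encode φ [])

code-injective : ∀ {φ ψ} → code φ ≡ code ψ → φ ≡ ψ
code-injective {φ} {ψ} = proj₁ ∘ encode-injective φ ψ ∘ bitsToℕ-injective

T-not⁺ : ∀ b → ¬ T b → T (not b)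
T-not⁺ false _  = tt
T-not⁺ true  ¬t = ¬t tt

T-not⁻ : ∀ b → T (not b) → ¬ T b
T-not⁻ false _ ()

infix 4 _⊨_
record _⊨_ (v : Formula → Bool) (φ : Formula) : Set where
  constructor ⊨⁺
  field ⊨⁻ : T (evalB v φ)
open _⊨_

module _ {v : Formula → Bool} where

  ⊨-¬⁺ : ∀ {φ} → ¬ v ⊨ φ → v ⊨ ¬ₘ φ
  ⊨-¬⁺ {φ} ¬t = ⊨⁺ (T-not⁺ (evalB v φ) (¬t ∘ ⊨⁺))

  ⊨-¬⁻ : ∀ {φ} → v ⊨ ¬ₘ φ → ¬ v ⊨ φ
  ⊨-¬⁻ {φ} (⊨⁺ t) = T-not⁻ (evalB v φ) t ∘ ⊨⁻

  ⊨-stable : ∀ {φ} → ¬ ¬ v ⊨ φ → v ⊨ φ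
  ⊨-stable {φ} ¬¬t = ⊨⁺ (decidable-stable (T? (evalB v φ)) λ ¬t → ¬¬t (¬t ∘ ⊨⁻))

  ⊨-∧⁺ : ∀ {φ ψ} → v ⊨ φ → v ⊨ ψ → v ⊨ φ ∧ₘ ψ
  ⊨-∧⁺ {φ} {ψ} (⊨⁺ s) (⊨⁺ t) = ⊨⁺ (from (T-∧ {evalB v φ} {evalB v ψ}) (s , t))

  ⊨-∧⁻ : ∀ {φ ψ} → v ⊨ φ ∧ₘ ψ → v ⊨ φ × v ⊨ ψ
  ⊨-∧⁻ {φ} {ψ} (⊨⁺ t) with to (T-∧ {evalB v φ} {evalB v ψ}) t
  ... | s , u = ⊨⁺ s , ⊨⁺ u

  ⊨-⇒⁺ : ∀ {φ ψ} → (v ⊨ φ → v ⊨ ψ) → v ⊨ φ ⇒ₘ ψ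
  ⊨-⇒⁺ f = ⊨-¬⁺ λ t → let s , u = ⊨-∧⁻ t in ⊨-¬⁻ u (f s)

  ⊨-⇒⁻ : ∀ {φ ψ} → v ⊨ φ ⇒ₘ ψ → v ⊨ φ → v ⊨ ψ
  ⊨-⇒⁻ t s = ⊨-stable λ ¬u → ⊨-¬⁻ t (⊨-∧⁺ s (⊨-¬⁺ ¬u))

  ⊨-⊤ : v ⊨ ⊤ₘ
  ⊨-⊤ = ⊨-¬⁺ λ t → let s , u = ⊨-∧⁻ t in ⊨-¬⁻ u s

  ⊨-⋀⁺ : ∀ φs → All (v ⊨_) φs → v ⊨ ⋀ φs
  ⊨-⋀⁺ []       []       = ⊨-⊤
  ⊨-⋀⁺ (_ ∷ φs) (t ∷ ts) = ⊨-∧⁺ t (⊨-⋀⁺ φs ts)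

  ⊨-⋀⁻ : ∀ φs → v ⊨ ⋀ φs → All (v ⊨_) φs
  ⊨-⋀⁻ []       _ = []
  ⊨-⋀⁻ (_ ∷ φs) t = let s , u = ⊨-∧⁻ t in s ∷ ⊨-⋀⁻ φs u

  ⊨-⋀-++ : ∀ φs ψs → v ⊨ ⋀ (φs ++ ψs) → v ⊨ ⋀ φs × v ⊨ ⋀ ψs
  ⊨-⋀-++ φs ψs t = let s , u = ++⁻ φs (⊨-⋀⁻ (φs ++ ψs) t) in ⊨-⋀⁺ φs s , ⊨-⋀⁺ ψs u

  ⊨-⋀-replicate : ∀ {θ φs} → All (_≡ θ) φs → v ⊨ θ → v ⊨ ⋀ φs
  ⊨-⋀-replicate []         _ = ⊨-⊤
  ⊨-⋀-replicate (refl ∷ e) t = ⊨-∧⁺ t (⊨-⋀-replicate e t)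

⋀-partition : ∀ {P Q : FormulaSet} φs → All (λ φ → P φ ⊎ Q φ) φs →
  Σ (List Formula) λ ψs → Σ (List Formula) λ χs → All P ψs × All Q χs ×
    (∀ v → v ⊨ ⋀ ψs → v ⊨ ⋀ χs → v ⊨ ⋀ φs)
⋀-partition []       []             = [] , [] , [] , [] , λ _ _ _ → ⊨-⊤
⋀-partition (φ ∷ φs) (inj₁ p ∷ pqs) =
  let ψs , χs , ps , qs , combine = ⋀-partition φs pqs
  in φ ∷ ψs , χs , p ∷ ps , qs , λ v s u → let s₁ , s₂ = ⊨-∧⁻ s in ⊨-∧⁺ s₁ (combine v s₂ u)
⋀-partition (φ ∷ φs) (inj₂ q ∷ pqs) =
  let ψs , χs , ps , qs , combine = ⋀-partition φs pqs
  in ψs , φ ∷ χs , ps , q ∷ qs , λ v s u → let u₁ , u₂ = ⊨-∧⁻ u in ⊨-∧⁺ u₁ (combine v s u₂)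

_▹_ : FormulaSet → Formula → FormulaSet
(Γ ▹ θ) φ = Γ φ ⊎ φ ≡ θ

module Lindenbaum {Λ : Formula → Set}
    (Λ-taut : ∀ {φ} → Tautology φ → Λ φ)
    (Λ-mp : ∀ {φ ψ} → Λ (φ ⇒ₘ ψ) → Λ φ → Λ ψ) where

  tautology : ∀ {φ} → (∀ v → v ⊨ φ) → Λ φ
  tautology t = Λ-taut λ v → to T-≡ (⊨⁻ (t v))

  tautological₁ : ∀ {φ ψ} → (∀ v → v ⊨ φ → v ⊨ ψ) → Λ φ → Λ ψ
  tautological₁ f = Λ-mp (tautology λ v → ⊨-⇒⁺ (f v))

  tautological₂ : ∀ {φ ψ χ} → (∀ v → v ⊨ φ → v ⊨ ψ → v ⊨ χ) → Λ φ → Λ ψ → Λ χ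
  tautological₂ f p q = Λ-mp (Λ-mp (tautology λ v → ⊨-⇒⁺ λ s → ⊨-⇒⁺ (f v s)) p) q

  ▹-inconsistent : ∀ {Γ θ} φs → All (Γ ▹ θ) φs → Λ (¬ₘ ⋀ φs) →
    Σ (List Formula) λ ψs → All Γ ψs × Λ (⋀ ψs ⇒ₘ ¬ₘ θ)
  ▹-inconsistent {θ = θ} φs Γθ ⊢¬φs =
    let ψs , χs , Γψs , χs≡θ , combine = ⋀-partition φs Γθ
    in ψs , Γψs , tautological₁ (λ v ¬φs → ⊨-⇒⁺ λ ψs-true → ⊨-¬⁺ λ θ-true →
         ⊨-¬⁻ ¬φs (combine v ψs-true (⊨-⋀-replicate χs≡θ θ-true))) ⊢¬φs

  stage : FormulaSet → ℕ → FormulaSet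
  stage B zero          = B
  stage B (suc n) θ     = stage B n θ ⊎ (code θ ≡ n × Consistent Λ (stage B n ▹ θ))

  Ext : FormulaSet → FormulaSet
  Ext B θ = ∃ λ n → stage B n θ

  module _ {B : FormulaSet} where

    stage-mono : ∀ {m n θ} → m ≤′ n → stage B m θ → stage B n θ
    stage-mono (_≤′_.≤′-reflexive refl) γ = γ
    stage-mono (_≤′_.≤′-step m≤n)       γ = inj₁ (stage-mono m≤n γ)

    stage-bound : ∀ φs → All (Ext B) φs → ∃ λ n → All (stage B n) φs
    stage-bound []       []             = 0 , []
    stage-bound (_ ∷ φs) ((m , γ) ∷ γs) =
      let n , γs′ = stage-bound φs γs
      in m ⊔ n , stage-mono (≤⇒≤′ (m≤m⊔n m n)) γ ∷ All-map (stage-mono (≤⇒≤′ (m≤n⊔m m n))) γs′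

    -- At most one formula enters at each stage, by injectivity of [code].
    stage-suc : ∀ {n} φs → All (stage B (suc n)) φs →
      All (stage B n) φs ⊎ ∃ λ θ → Consistent Λ (stage B n ▹ θ) × All (stage B n ▹ θ) φs
    stage-suc []       []                = inj₁ []
    stage-suc {n} (φ ∷ φs) (inj₂ (cφ , k) ∷ γs) = inj₂ (φ , k , inj₂ refl ∷ All-map old-or-φ γs)
      where old-or-φ : ∀ {ψ} → stage B (suc n) ψ → (stage B n ▹ φ) ψ
            old-or-φ (inj₁ γ)        = inj₁ γ
            old-or-φ (inj₂ (cψ , _)) = inj₂ (code-injective (trans cψ (sym cφ)))
    stage-suc (φ ∷ φs) (inj₁ γ ∷ γs) with stage-suc φs γs
    ... | inj₁ γs′            = inj₁ (γ ∷ γs′)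
    ... | inj₂ (θ , k , γs′) = inj₂ (θ , k , inj₁ γ ∷ γs′)

    stage-consistent : Consistent Λ B → ∀ n → Consistent Λ (stage B n)
    stage-consistent cB zero    = cB
    stage-consistent cB (suc n) φs γs with stage-suc φs γs
    ... | inj₁ γs′           = stage-consistent cB n φs γs′
    ... | inj₂ (_ , k , γs′) = k φs γs′

    ⊆Ext : ∀ {θ} → B θ → Ext B θ
    ⊆Ext γ = 0 , γ

    Ext-intro : ∀ {θ} → Consistent Λ (stage B (code θ) ▹ θ) → Ext B θ
    Ext-intro {θ} k = suc (code θ) , inj₂ (refl , k)

  module Maximal (B : FormulaSet) (cB : Consistent Λ B) where
    consistent : Consistent Λ (Ext B)
    consistent φs γs = let n , γs′ = stage-bound φs γs in stage-consistent cB n φs γs′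

    Ext-elim : ∀ {θ} → Ext B θ → Consistent Λ (stage B (code θ) ▹ θ)
    Ext-elim γθ φs γs = consistent φs (All-map [ (λ γ → _ , γ) , (λ { refl → γθ }) ] γs)

    stable : ∀ {θ} → ¬ ¬ Ext B θ → Ext B θ
    stable ¬¬γ = Ext-intro λ φs γs ⊢¬φs → ¬¬γ λ γ → Ext-elim γ φs γs ⊢¬φs

    closed : ∀ {θ} φs → All (Ext B) φs → Λ (⋀ φs ⇒ₘ θ) → Ext B θ
    closed {θ} φs γs ⊢φs⇒θ = Ext-intro λ χs γθs ⊢¬χs →
      let ψs , γψs , ⊢ψs⇒¬θ = ▹-inconsistent χs γθs ⊢¬χs
      in consistent (ψs ++ φs) (++⁺ (All-map (λ γ → _ , γ) γψs) γs)
           (tautological₂ (λ v ψs⇒¬θ φs⇒θ → ⊨-¬⁺ λ t →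
              let ψs-true , φs-true = ⊨-⋀-++ ψs φs t
              in ⊨-¬⁻ (⊨-⇒⁻ ψs⇒¬θ ψs-true) (⊨-⇒⁻ φs⇒θ φs-true)) ⊢ψs⇒¬θ ⊢φs⇒θ)

    theorem : ∀ {θ} → Λ θ → Ext B θ
    theorem ⊢θ = closed [] [] (tautological₁ (λ v t → ⊨-⇒⁺ λ _ → t) ⊢θ)

    closed-⇒ : ∀ {φ ψ} → Ext B φ → Λ (φ ⇒ₘ ψ) → Ext B ψ
    closed-⇒ γ ⊢φ⇒ψ = closed (_ ∷ []) (γ ∷ [])
      (tautological₁ (λ v t → ⊨-⇒⁺ λ s → ⊨-⇒⁻ t (proj₁ (⊨-∧⁻ s))) ⊢φ⇒ψ)

    modus-ponens : ∀ {φ ψ} → Ext B φ → Ext B (φ ⇒ₘ ψ) → Ext B ψ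
    modus-ponens γφ γφ⇒ψ = closed (_ ∷ _ ∷ []) (γφ ∷ γφ⇒ψ ∷ []) (tautology λ v → ⊨-⇒⁺ λ s →
      let s₁ , s₂ = ⊨-∧⁻ s in ⊨-⇒⁻ (proj₁ (⊨-∧⁻ s₂)) s₁)

    ∧⁺ : ∀ {φ ψ} → Ext B φ → Ext B ψ → Ext B (φ ∧ₘ ψ)
    ∧⁺ γφ γψ = closed (_ ∷ _ ∷ []) (γφ ∷ γψ ∷ []) (tautology λ v → ⊨-⇒⁺ λ s →
      let s₁ , s₂ = ⊨-∧⁻ s in ⊨-∧⁺ s₁ (proj₁ (⊨-∧⁻ s₂)))

    ∧⁻ : ∀ {φ ψ} → Ext B (φ ∧ₘ ψ) → Ext B φ × Ext B ψ
    ∧⁻ γ = closed-⇒ γ (tautology λ v → ⊨-⇒⁺ (proj₁ ∘ ⊨-∧⁻)) ,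
           closed-⇒ γ (tautology λ v → ⊨-⇒⁺ (proj₂ ∘ ⊨-∧⁻))

    ¬⁻ : ∀ {φ} → Ext B (¬ₘ φ) → ¬ Ext B φ
    ¬⁻ γ¬φ γφ = consistent (_ ∷ _ ∷ []) (γφ ∷ γ¬φ ∷ []) (tautology λ v → ⊨-¬⁺ λ s →
      let s₁ , s₂ = ⊨-∧⁻ s in ⊨-¬⁻ (proj₁ (⊨-∧⁻ s₂)) s₁)

    ¬⁺ : ∀ {φ} → ¬ Ext B φ → Ext B (¬ₘ φ)
    ¬⁺ ¬γ = Ext-intro λ χs γs ⊢¬χs →
      let ψs , γψs , ⊢ψs⇒¬¬φ = ▹-inconsistent χs γs ⊢¬χs
      in ¬γ (closed ψs (All-map (λ γ → _ , γ) γψs)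
               (tautological₁ (λ v t → ⊨-⇒⁺ λ s → ⊨-stable (⊨-¬⁻ (⊨-⇒⁻ t s) ∘ ⊨-¬⁺)) ⊢ψs⇒¬¬φ))

open Lindenbaum {8f} taut mp

□-mono : ∀ {φ ψ} → 8f (φ ⇒ₘ ψ) → 8f (□ φ ⇒ₘ □ ψ)
□-mono {φ} {ψ} ⊢φ⇒ψ = mp (K φ ψ) (nec ⊢φ⇒ψ)

⇒-trans : ∀ {φ ψ χ} → 8f (φ ⇒ₘ ψ) → 8f (ψ ⇒ₘ χ) → 8f (φ ⇒ₘ χ)
⇒-trans = tautological₂ λ v s t → ⊨-⇒⁺ (⊨-⇒⁻ t ∘ ⊨-⇒⁻ s)

contraposition : ∀ {φ ψ} → 8f (¬ₘ φ ⇒ₘ ψ) → 8f (¬ₘ ψ ⇒ₘ φ)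
contraposition = tautological₁ λ v t → ⊨-⇒⁺ λ ¬ψ → ⊨-stable λ ¬φ → ⊨-¬⁻ ¬ψ (⊨-⇒⁻ t (⊨-¬⁺ ¬φ))

¬⇒□¬□ : ∀ φ → 8f (¬ₘ φ ⇒ₘ □ ¬ₘ □ φ)
¬⇒□¬□ φ = contraposition (axB φ)

□⇒□□◇ : ∀ φ → 8f (□ φ ⇒ₘ □ □ ◇ φ)
□⇒□□◇ φ = □-mono (tautological₁ (λ v t → ⊨-⇒⁺ λ s → ⊨-stable λ ¬u → ⊨-¬⁻ (⊨-⇒⁻ t (⊨-¬⁺ ¬u)) s) (axB (¬ₘ φ)))

□□⇒id : ∀ φ → 8f (□ □ φ ⇒ₘ φ)
□□⇒id φ = ⇒-trans (axD (□ φ)) (axB φ)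

□^ : ℕ → Formula → Formula
□^ zero    φ = φ
□^ (suc n) φ = □ □^ n φ

□^-comm : ∀ n φ → □^ n (□ φ) ≡ □ □^ n φ
□^-comm zero    φ = refl
□^-comm (suc n) φ = cong □_ (□^-comm n φ)

□^-comm₂ : ∀ n φ → □^ n (□ □ φ) ≡ □ □ □^ n φ
□^-comm₂ n φ = trans (□^-comm n (□ φ)) (cong □_ (□^-comm n φ))

-- □□φ → φ and □□□φ → φ together strip any tower of boxes above □□φ.
□^□□⇒id : ∀ n φ → 8f (□^ n (□ □ φ) ⇒ₘ φ)
□^□□⇒id zero          φ = □□⇒id φ
□^□□⇒id (suc zero)    φ = ax3 φ
□^□□⇒id (suc (suc n)) φ = ⇒-trans (□□⇒id (□^ n (□ □ φ))) (□^□□⇒id n φ)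

□□⇒□□□^□^ : ∀ n φ → 8f (□ □ φ ⇒ₘ □ □ □^ n (□^ n φ))
□□⇒□□□^□^ zero    φ = tautology λ v → ⊨-⇒⁺ λ t → t
□□⇒□□□^□^ (suc n) φ =
  subst (λ ψ → 8f (□ □ φ ⇒ₘ □ □ □ ψ)) (sym (□^-comm n (□^ n φ)))
    (⇒-trans (□□⇒□□□^□^ n φ) (ax4 (□^ n (□^ n φ))))

infix 4 _R_ _R[_]_

_R_ : FormulaSet → FormulaSet → Set
Γ R Δ = ∀ φ → Γ (□ φ) → Δ φ

data _R[_]_ : FormulaSet → ℕ → FormulaSet → Set₁ where
  ε   : ∀ {Γ} → Γ R[ 0 ] Γ
  _◅_ : ∀ {Γ Δ Θ n} → Γ R Δ → Δ R[ n ] Θ → Γ R[ suc n ] Θ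

infixr 5 _◅_ _◅◅_

_◅◅_ : ∀ {Γ Δ Θ m n} → Γ R[ m ] Δ → Δ R[ n ] Θ → Γ R[ m + n ] Θ
ε       ◅◅ q = q
(r ◅ p) ◅◅ q = r ◅ (p ◅◅ q)

R[]-transport : ∀ {Γ Δ n φ} → Γ R[ n ] Δ → Γ (□^ n φ) → Δ φ
R[]-transport ε       γ = γ
R[]-transport (r ◅ p) γ = R[]-transport p (r _ γ)

module Canonical (B : FormulaSet) (cB : Consistent 8f B) where
  open Maximal B cB public

  □-closed : ∀ {χ} φs → All (λ φ → Ext B (□ φ)) φs → 8f (⋀ φs ⇒ₘ χ) → Ext B (□ χ)
  □-closed []       []       ⊢⊤⇒χ = theorem (nec (tautological₁ (λ v t → ⊨-⇒⁻ t ⊨-⊤) ⊢⊤⇒χ))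
  □-closed {χ} (φ ∷ φs) (γ ∷ γs) ⊢φφs⇒χ =
    modus-ponens γ (modus-ponens (□-closed φs γs ⊢φs⇒φ⇒χ) (theorem (K φ χ)))
    where ⊢φs⇒φ⇒χ = tautological₁ (λ v t → ⊨-⇒⁺ λ s → ⊨-⇒⁺ λ u → ⊨-⇒⁻ t (⊨-∧⁺ u s)) ⊢φφs⇒χ

  ¬□⊥ : ¬ Ext B (□ ⊥ₘ)
  ¬□⊥ γ = ¬⁻ (closed-⇒ γ (axD ⊥ₘ)) (theorem (nec (tautology λ v → ⊨-¬⁺ λ t →
    let s , u = ⊨-∧⁻ t in ⊨-¬⁻ u s)))

R-sym : ∀ {B C} → Consistent 8f B → Consistent 8f C → Ext B R Ext C → Ext C R Ext B
R-sym {B} {C} cB cC BRC φ γ□φ = 𝔅.stable λ φ∉B →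
  ℭ.¬⁻ (BRC _ (𝔅.closed-⇒ (𝔅.¬⁺ φ∉B) (¬⇒□¬□ φ))) γ□φ
  where module 𝔅 = Canonical B cB
        module ℭ = Canonical C cC

-- Pump □□φ up with axiom 4 so that it survives n steps of R, then strip.
□□-reach : ∀ {B C n φ} → Consistent 8f B → Consistent 8f C →
  Ext B R[ n ] Ext C → Ext B (□ □ φ) → Ext C φ
□□-reach {B} {C} {n} {φ} cB cC p γ = ℭ.closed-⇒ (subst (Ext C) (sym (□^-comm₂ n φ)) γ′) (□^□□⇒id n φ)
  where module 𝔅 = Canonical B cB
        module ℭ = Canonical C cC
        γ′ : Ext C (□ □ □^ n φ)
        γ′ = R[]-transport p (subst (Ext B) (sym (□^-comm₂ n (□^ n φ))) (𝔅.closed-⇒ γ (□□⇒□□□^□^ n φ)))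

data Node : Set where
  root    : Node
  witness : Node → Formula → Node
  join    : Node → Node → Node

encodeNode : Node → List Bool → List Bool
encodeNode root          r = false ∷ r
encodeNode (witness x φ) r = true ∷ false ∷ encodeNode x (encode φ r)
encodeNode (join x y)    r = true ∷ true ∷ encodeNode x (encodeNode y r)

encodeNode-injective : ∀ x y {r s} → encodeNode x r ≡ encodeNode y s → x ≡ y × r ≡ s
encodeNode-injective root root e = refl , ∷-injectiveʳ e
encodeNode-injective (witness x φ) (witness y ψ) e with encodeNode-injective x y (∷∷-injective e)
... | refl , e′ with encode-injective φ ψ e′
...   | refl , r≡s = refl , r≡s
encodeNode-injective (join x₁ x₂) (join y₁ y₂) e with encodeNode-injective x₁ y₁ (∷∷-injective e)
... | refl , e′ with encodeNode-injective x₂ y₂ e′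
...   | refl , r≡s = refl , r≡s
encodeNode-injective root          (witness _ _) ()
encodeNode-injective root          (join _ _)    ()
encodeNode-injective (witness _ _) root          ()
encodeNode-injective (witness _ _) (join _ _)    ()
encodeNode-injective (join _ _)    root          ()
encodeNode-injective (join _ _)    (witness _ _) ()

codeNode : Node → ℕ
codeNode x = bitsToℕ (encodeNode x [])

codeNode-injective : ∀ {x y} → codeNode x ≡ codeNode y → x ≡ y
codeNode-injective {x} {y} = proj₁ ∘ encodeNode-injective x y ∘ bitsToℕ-injective

infix 4 _≟ₙ_ _~_

_≟ₙ_ : (x y : Node) → Dec (x ≡ y)
x ≟ₙ y with codeNode x ℕ.≟ codeNode y
... | yes e = yes (codeNode-injective e)
... | no ≢  = no (≢ ∘ cong codeNode)

open import Data.List.Membership.DecPropositional _≟ₙ_ using (_∈?_)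

parents : Node → List Node
parents root          = []
parents (witness x _) = x ∷ []
parents (join x y)    = x ∷ y ∷ []

Parent : Node → Node → Set
Parent u v = u ∈ parents v

_~_ : Node → Node → Set
u ~ v = Parent u v ⊎ Parent v u

~-sym : ∀ {u v} → u ~ v → v ~ u
~-sym = swap

-- A common neighbour of x and y other than a common child: a common parent,
-- or a parent of one of them that is a child of the other.
ShareNeighbour : Node → Node → Set
ShareNeighbour x y = Any (_∈ parents y) (parents x)
                   ⊎ Any (λ w → x ∈ parents w) (parents y)
                   ⊎ Any (λ w → y ∈ parents w) (parents x)

shareNeighbour? : ∀ x y → Dec (ShareNeighbour x y)
shareNeighbour? x y = any? (_∈? parents y) (parents x)
               ⊎-dec any? (λ w → x ∈? parents w) (parents y)
               ⊎-dec any? (λ w → y ∈? parents w) (parents x)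

-- join x y is only a point of the plane when x and y still lack a common
-- neighbour; the order on codes picks one of join x y and join y x.
-- Validity is Boolean so that proofs of it are irrelevant (see point-≡).
valid : Node → Bool
valid root          = true
valid (witness x _) = valid x
valid (join x y)    = valid x ∧ valid y ∧ ⌊ codeNode x <? codeNode y ⌋ ∧ ⌊ ¬? (shareNeighbour? x y) ⌋

Valid : Node → Set
Valid = T ∘ valid

valid-join⁻ : ∀ {x y} → Valid (join x y) →
  Valid x × Valid y × codeNode x < codeNode y × ¬ ShareNeighbour x y
valid-join⁻ {x} {y} v =
  let vx , v₁ = to (T-∧ {valid x}) v
      vy , v₂ = to (T-∧ {valid y}) v₁
      lt , v₃ = to (T-∧ {⌊ codeNode x <? codeNode y ⌋}) v₂
  in vx , vy , toWitness lt , toWitness v₃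

valid-join⁺ : ∀ {x y} → Valid x → Valid y → codeNode x < codeNode y → ¬ ShareNeighbour x y →
  Valid (join x y)
valid-join⁺ {x} {y} vx vy lt ¬s =
  from (T-∧ {valid x}) (vx , from (T-∧ {valid y}) (vy ,
    from (T-∧ {⌊ codeNode x <? codeNode y ⌋}) (fromWitness lt , fromWitness ¬s)))

Parent-valid : ∀ {p t} → Valid t → Parent p t → Valid p
Parent-valid {t = witness _ _} v (here refl)         = v
Parent-valid {t = join x y}    v (here refl)         = proj₁ (valid-join⁻ {x} {y} v)
Parent-valid {t = join x y}    v (there (here refl)) = proj₁ (proj₂ (valid-join⁻ {x} {y} v))

rank : Node → ℕ
rank root          = 0
rank (witness x _) = suc (rank x)
rank (join x y)    = suc (rank x + rank y)

Parent⇒rank< : ∀ {u v} → Parent u v → rank u < rank v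
Parent⇒rank< {v = witness x _} (here refl)         = n<1+n _
Parent⇒rank< {v = join x y}    (here refl)         = s≤s (m≤m+n _ _)
Parent⇒rank< {v = join x y}    (there (here refl)) = s≤s (m≤n+m _ _)

no-Parent-4-cycle : ∀ {a b c d} → Parent a b → Parent b c → Parent c d → Parent d a → ⊥
no-Parent-4-cycle p q r s = <-irrefl refl
  (<-trans (Parent⇒rank< p) (<-trans (Parent⇒rank< q) (<-trans (Parent⇒rank< r) (Parent⇒rank< s))))

join-unique : ∀ {u v w} → codeNode u < codeNode v → Valid w → Parent u w → Parent v w → join u v ≡ w
join-unique {w = witness _ _} lt _ (here refl) (here refl) = ⊥-elim (<-irrefl refl lt)
join-unique {w = join _ _}    lt _ (here refl) (here refl) = ⊥-elim (<-irrefl refl lt)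
join-unique {w = join _ _}    lt _ (here refl) (there (here refl)) = refl
join-unique {w = join p q}    lt v (there (here refl)) (here refl) =
  ⊥-elim (<-asym lt (proj₁ (proj₂ (proj₂ (valid-join⁻ {p} {q} v)))))
join-unique {w = join _ _}    lt _ (there (here refl)) (there (here refl)) = ⊥-elim (<-irrefl refl lt)

join-only-common-neighbour : ∀ {u v w} → Valid (join u v) → Valid w → u ~ w → w ~ v → join u v ≡ w
join-only-common-neighbour {u} {v} vj vw u~w w~v with valid-join⁻ {u} {v} vj
... | _ , _ , lt , ¬s with u~w | w~v
...   | inj₁ u∈w | inj₁ w∈v = ⊥-elim (¬s (inj₂ (inj₁ (lose w∈v u∈w))))
...   | inj₁ u∈w | inj₂ v∈w = join-unique lt vw u∈w v∈w
...   | inj₂ w∈u | inj₁ w∈v = ⊥-elim (¬s (inj₁ (lose w∈u w∈v)))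
...   | inj₂ w∈u | inj₂ v∈w = ⊥-elim (¬s (inj₂ (inj₂ (lose w∈u v∈w))))

two-parents : ∀ {x y z w} → Valid x → Valid w → Parent y x → Parent z x → y ~ w → w ~ z →
  y ≡ z ⊎ x ≡ w
two-parents {witness _ _} _  _  (here refl)         (here refl)         _   _   = inj₁ refl
two-parents {join _ _}    _  _  (here refl)         (here refl)         _   _   = inj₁ refl
two-parents {join _ _}    _  _  (there (here refl)) (there (here refl)) _   _   = inj₁ refl
two-parents {join _ _}    vx vw (here refl)         (there (here refl)) y~w w~z =
  inj₂ (join-only-common-neighbour vx vw y~w w~z)
two-parents {join _ _}    vx vw (there (here refl)) (here refl)         y~w w~z =
  inj₂ (join-only-common-neighbour vx vw (~-sym w~z) (~-sym y~w))

-- Unless the 4-cycle is a directed cycle of parents, some vertex has both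
-- of its cycle-neighbours as parents.
~-4-cycle : ∀ {a b c d} → Valid a → Valid b → Valid c → Valid d →
  a ~ b → b ~ c → c ~ d → d ~ a → a ≡ c ⊎ b ≡ d
~-4-cycle va vb vc vd (inj₁ ab) (inj₂ cb) c~d d~a = two-parents vb vd ab cb (~-sym d~a) (~-sym c~d)
~-4-cycle va vb vc vd (inj₂ ba) b~c c~d (inj₁ da) = swap (two-parents va vc ba da b~c c~d)
~-4-cycle va vb vc vd a~b (inj₁ bc) (inj₂ dc) d~a =
  map₁ sym (swap (two-parents vc va bc dc (~-sym a~b) (~-sym d~a)))
~-4-cycle va vb vc vd a~b b~c (inj₁ cd) (inj₂ ad) =
  map sym sym (two-parents vd vb cd ad (~-sym b~c) (~-sym a~b))
~-4-cycle _ _ _ _ (inj₁ ab) (inj₁ bc) (inj₁ cd) (inj₁ da) = ⊥-elim (no-Parent-4-cycle ab bc cd da)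
~-4-cycle _ _ _ _ (inj₂ ba) (inj₂ cb) (inj₂ dc) (inj₂ ad) = ⊥-elim (no-Parent-4-cycle ba ad dc cb)

shared-neighbour : ∀ {x y} → Valid x → Valid y → ShareNeighbour x y →
  Σ Node λ w → Valid w × x ~ w × w ~ y
shared-neighbour vx vy (inj₁ s) =
  let w , w∈x , w∈y = find s in w , Parent-valid vx w∈x , inj₂ w∈x , inj₁ w∈y
shared-neighbour vx vy (inj₂ (inj₁ s)) =
  let w , w∈y , x∈w = find s in w , Parent-valid vy w∈y , inj₁ x∈w , inj₁ w∈y
shared-neighbour vx vy (inj₂ (inj₂ s)) =
  let w , w∈x , y∈w = find s in w , Parent-valid vx w∈x , inj₂ w∈x , inj₂ y∈w

common-neighbour-< : ∀ {x y} → Valid x → Valid y → codeNode x < codeNode y →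
  Σ Node λ w → Valid w × x ~ w × w ~ y
common-neighbour-< {x} {y} vx vy lt with shareNeighbour? x y
... | yes s = shared-neighbour vx vy s
... | no ¬s = join x y , valid-join⁺ vx vy lt ¬s , inj₁ (here refl) , inj₂ (there (here refl))

common-neighbour : ∀ {x y} → Valid x → Valid y → Σ Node λ w → Valid w × x ~ w × w ~ y
common-neighbour {x} {y} vx vy with x ≟ₙ y
... | yes refl = witness x ⊥ₘ , vx , inj₁ (here refl) , inj₂ (here refl)
... | no x≢y with <-cmp (codeNode x) (codeNode y)
...   | tri< lt _ _ = common-neighbour-< vx vy lt
...   | tri≈ _ e _  = ⊥-elim (x≢y (codeNode-injective e))
...   | tri> _ _ gt = let w , vw , y~w , w~x = common-neighbour-< vy vx gt
                      in w , vw , ~-sym w~x , ~-sym y~w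

module Construction (S : FormulaSet) (cS : Consistent 8f S) where

  base : Node → FormulaSet
  base root          = S
  base (witness x ψ) θ = Ext (base x) (□ θ) ⊎ (θ ≡ ¬ₘ ψ × Ext (base x) (¬ₘ □ ψ))
  base (join x y)    θ = Ext (base x) (□ θ) ⊎ Ext (base y) (□ θ)

  label : Node → FormulaSet
  label t = Ext (base t)

  Parent⇒R : ∀ {p t} → Parent p t → label p R label t
  Parent⇒R {t = witness _ _} (here refl)         _ γ = ⊆Ext (inj₁ γ)
  Parent⇒R {t = join _ _}    (here refl)         _ γ = ⊆Ext (inj₁ γ)
  Parent⇒R {t = join _ _}    (there (here refl)) _ γ = ⊆Ext (inj₂ γ)

  R[]-from-root : ∀ t → ∃ λ n → label root R[ n ] label t
  R[]-from-root root          = 0 , ε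
  R[]-from-root (witness x ψ) = let _ , p = R[]-from-root x in _ , p ◅◅ Parent⇒R {t = witness x ψ} (here refl) ◅ ε
  R[]-from-root (join x y)    = let _ , p = R[]-from-root x in _ , p ◅◅ Parent⇒R {t = join x y} (here refl) ◅ ε

  witness-consistent : ∀ {x ψ} → Consistent 8f (base x) → Consistent 8f (base (witness x ψ))
  witness-consistent {x} {ψ} cx φs γs ⊢¬φs with ⋀-partition φs γs
  ... | ψs , [] , □ψs , [] , combine =
    X.¬□⊥ (X.□-closed ψs □ψs (tautological₁ (λ v t → ⊨-⇒⁺ λ s →
      ⊥-elim (⊨-¬⁻ t (combine v s ⊨-⊤))) ⊢¬φs))
    where module X = Canonical (base x) cx
  ... | ψs , _ ∷ χs , □ψs , (refl , ¬□ψ) ∷ χs≡¬ψ , combine =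
    X.¬⁻ ¬□ψ (X.□-closed ψs □ψs (tautological₁ (λ v t → ⊨-⇒⁺ λ s → ⊨-stable λ ¬ψ →
      ⊨-¬⁻ t (combine v s (⊨-⋀-replicate (refl ∷ All-map proj₁ χs≡¬ψ) (⊨-¬⁺ ¬ψ)))) ⊢¬φs))
    where module X = Canonical (base x) cx

  -- An inconsistency gives □α ∈ label x and □¬α ∈ label y; by axiom B also
  -- □□◇α ∈ label x, and □□-reach carries ◇α to y.
  join-consistent : ∀ {x y n} → Consistent 8f (base x) → Consistent 8f (base y) →
    label x R[ n ] label y → Consistent 8f (base (join x y))
  join-consistent {x} {y} cx cy p φs γs ⊢¬φs with ⋀-partition φs γs
  ... | ψs , χs , □ψs , □χs , combine =
    Y.¬⁻ (□□-reach cx cy p (X.closed-⇒ □α (□⇒□□◇ (⋀ ψs)))) □¬α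
    where
      module X = Canonical (base x) cx
      module Y = Canonical (base y) cy
      □α : label x (□ ⋀ ψs)
      □α = X.□-closed ψs □ψs (tautology λ v → ⊨-⇒⁺ λ t → t)
      □¬α : label y (□ ¬ₘ ⋀ ψs)
      □¬α = Y.□-closed χs □χs (tautological₁ (λ v t → ⊨-⇒⁺ λ u → ⊨-¬⁺ λ s →
        ⊨-¬⁻ t (combine v s u)) ⊢¬φs)

  consistent-and-R[]-to-root : ∀ t → Consistent 8f (base t) × ∃ λ n → label t R[ n ] label root
  consistent-and-R[]-to-root root = cS , 0 , ε
  consistent-and-R[]-to-root (witness x ψ) =
    let cx , _ , p = consistent-and-R[]-to-root x
        c = witness-consistent cx
    in c , _ , R-sym cx c (Parent⇒R {t = witness x ψ} (here refl)) ◅ p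
  consistent-and-R[]-to-root (join x y) =
    let cx , _ , p = consistent-and-R[]-to-root x
        cy , _     = consistent-and-R[]-to-root y
        c = join-consistent cx cy (p ◅◅ proj₂ (R[]-from-root y))
    in c , _ , R-sym cx c (Parent⇒R {t = join x y} (here refl)) ◅ p

  base-consistent : ∀ t → Consistent 8f (base t)
  base-consistent = proj₁ ∘ consistent-and-R[]-to-root

  ~⇒R : ∀ {u v} → u ~ v → label u R label v
  ~⇒R             (inj₁ u∈v) = Parent⇒R u∈v
  ~⇒R {u} {v} (inj₂ v∈u) = R-sym (base-consistent v) (base-consistent u) (Parent⇒R v∈u)

  Point : Set
  Point = Σ Node Valid

  point-≡ : ∀ {a b : Point} → proj₁ a ≡ proj₁ b → a ≡ b
  point-≡ {x , va} {.x , vb} refl = cong (x ,_) (T-irrelevant va vb)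

  plane : Frame
  plane = record { X = Point ; I = λ a b → proj₁ a ~ proj₁ b }

  model : Model plane
  model = record { V = λ n a → label (proj₁ a) (var n) }

  plane-O5 : O5 plane
  plane-O5 (x , vx) (y , vy) = let w , vw , x~w , w~y = common-neighbour vx vy in (w , vw) , x~w , w~y

  plane-O3 : O3 plane
  plane-O3 (a , va) (b , vb) (c , vc) (d , vd) a~b b~c c~d d~a =
    map point-≡ point-≡ (~-4-cycle va vb vc vd a~b b~c c~d d~a)

  plane-non-degenerate : NonDegenerate plane
  plane-non-degenerate =
    (root , tt) , (w₁ , tt) , (w₂ , tt) , (w₃ , tt) ,
    inj₁ (here refl) , inj₁ (here refl) , inj₁ (here refl) ,
    (λ ()) ∘ cong proj₁ , (λ ()) ∘ cong proj₁ , ¬root~w₂ , ¬w₁~w₃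
    where
      w₁ w₂ w₃ : Node
      w₁ = witness root ⊥ₘ
      w₂ = witness w₁ ⊥ₘ
      w₃ = witness w₂ ⊥ₘ
      ¬root~w₂ : ¬ root ~ w₂
      ¬root~w₂ (inj₁ (here ()))
      ¬root~w₂ (inj₁ (there ()))
      ¬root~w₂ (inj₂ ())
      ¬w₁~w₃ : ¬ w₁ ~ w₃
      ¬w₁~w₃ (inj₁ (here ()))
      ¬w₁~w₃ (inj₁ (there ()))
      ¬w₁~w₃ (inj₂ (here ()))
      ¬w₁~w₃ (inj₂ (there ()))

  truth : ∀ φ (a : Point) → Sat plane model a φ ⇔ label (proj₁ a) φ
  truth (var n)  a       = mk⇔ (λ s → s) (λ γ → γ)
  truth (¬ₘ φ)   (t , v) = mk⇔ (λ ¬s → T.¬⁺ (¬s ∘ from (truth φ (t , v))))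
                               (λ γ → T.¬⁻ γ ∘ to (truth φ (t , v)))
    where module T = Canonical (base t) (base-consistent t)
  truth (φ ∧ₘ ψ) (t , v) = mk⇔ (λ (s , u) → T.∧⁺ (to (truth φ (t , v)) s) (to (truth ψ (t , v)) u))
                               (λ γ → let γφ , γψ = T.∧⁻ γ
                                      in from (truth φ (t , v)) γφ , from (truth ψ (t , v)) γψ)
    where module T = Canonical (base t) (base-consistent t)
  truth (□ φ)    (t , v) = mk⇔ box⁺ box⁻
    where
      module T = Canonical (base t) (base-consistent t)
      module W = Canonical (base (witness t φ)) (base-consistent (witness t φ))
      box⁺ : Sat plane model (t , v) (□ φ) → label t (□ φ)
      box⁺ s = T.stable λ □φ∉t → W.¬⁻ (⊆Ext (inj₂ (refl , T.¬⁺ □φ∉t)))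
        (to (truth φ (witness t φ , v)) (s (witness t φ , v) (inj₁ (here refl))))
      box⁻ : label t (□ φ) → Sat plane model (t , v) (□ φ)
      box⁻ γ (u , w) t~u = from (truth φ (u , w)) (~⇒R t~u φ γ)

theorem6p4 : (S : FormulaSet) → Consistent 8f S →
    Σ Frame λ F → IsEllipticPlane F × NonDegenerate F ×
      Σ (Model F) λ M → SatisfiableIn F M S
theorem6p4 S cS =
  plane , (plane-O5 , plane-O3) , plane-non-degenerate ,
  model , (root , tt) , λ φ φ∈S → from (truth φ (root , tt)) (⊆Ext φ∈S)
  where open Construction S cS
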